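{- Consider the random key graph $G(n,K_n,P_n)$ with $P_n\ge 3K_n$. Let $v_i,v_j,v_t$ be three distinct nodes, let $\Gamma_{it}$ be the event $S_i\cap S_t\ne\emptyset$ and $\Gamma_{jt}$ the event $S_j\cap S_t\neq\emptyset$, and write $S_{ij}=S_i\cap S_j$. Then for every $u\in\{0,1,\dots,K_n\}$, $$\mathbb{P}\big[\Gamma_{it}\cap\Gamma_{jt}\,\big|\,|S_{ij}|=u\big]\le K_n^{ -1}s_nu+2s_n^2.$$
   Context: The random key graph $G(n,K_n,P_n)$ is defined on nodes $v_1,\dots,v_n$. There is a pool of $P_n$ distinct keys. Each node $v_i$ independently receives a key set $S_i$, chosen uniformly at random among all $K_n$-element subsets of the pool. Nodes $v_i$ and $v_j$ are adjacent iff $S_i\cap S_j\ne\emptyset$. Here $s_n=\mathbb{P}[S_i\cap S_j\ne\emptyset]=1-\binom{P_n-K_n}{K_n}/\binom{P_n}{K_n}$ for $P_n>2K_n$. -}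

module Defs where

open import Data.Nat using (ℕ; zero; suc; _∸_; _≟_)
open import Data.Nat.Combinatorics using (_C_)
open import Data.Integer using (+_)
open import Data.List using (List; []; _∷_; [_]; map; _++_; filter; length; concatMap)
open import Data.Vec using () renaming ([] to v[]; _∷_ to _v∷_)
open import Data.Product using (_×_; _,_)
open import Data.Fin.Subset using (Subset; inside; outside; _∩_; ∣_∣)
open import Data.Rational using (ℚ; _/_; 0ℚ; 1ℚ; _-_; _+_; _*_)
open import Relation.Nullary.Decidable using (_×-dec_; ¬?)

allSubsets : (n : ℕ) → List (Subset n)
allSubsets zero = [ v[] ]
allSubsets (suc n) = map (outside v∷_) (allSubsets n) ++ map (inside v∷_) (allSubsets n)

keyRings : (P K : ℕ) → List (Subset P)
keyRings P K = filter (λ S → ∣ S ∣ ≟ K) (allSubsets P)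

triples : (P K : ℕ) → List (Subset P × Subset P × Subset P)
triples P K =
  concatMap (λ Si → concatMap (λ Sj → map (λ St → Si , Sj , St) (keyRings P K)) (keyRings P K)) (keyRings P K)

-- a / b as a rational (b = 0 gives 0; never used with b = 0 under the hypotheses)
frac : ℕ → ℕ → ℚ
frac a zero = 0ℚ
frac a (suc b) = (+ a) / suc b

condCount : (P K u : ℕ) → ℕ
condCount P K u = length (filter (λ { (Si , Sj , St) → ∣ Si ∩ Sj ∣ ≟ u }) (triples P K))

jointCount : (P K u : ℕ) → ℕ
jointCount P K u =
  length (filter (λ { (Si , Sj , St) → (∣ Si ∩ Sj ∣ ≟ u) ×-dec ((¬? (∣ Si ∩ St ∣ ≟ 0)) ×-dec (¬? (∣ Sj ∩ St ∣ ≟ 0))) }) (triples P K))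

-- P[ Γ_it ∩ Γ_jt | |S_ij| = u ]  (uniform measure on triples of key rings)
condProb : (P K u : ℕ) → ℚ
condProb P K u = frac (jointCount P K u) (condCount P K u)

edgeProb : (P K : ℕ) → ℚ
edgeProb P K = 1ℚ - frac ((P ∸ K) C K) (P C K)

module Submission where

-- Fix rings S_i, S_j with |S_i ∩ S_j| = u, and let N = C(P,K), M = C(P−K,K) (rings avoiding
-- a given ring) and R = C(P−(2K−u),K) (rings avoiding S_i ∪ S_j).  By inclusion–exclusion
-- N − 2M + R rings S_t meet both, so if A counts the pairs (S_i,S_j) with |S_i ∩ S_j| = u,
-- the joint event has A·(N − 2M + R) outcomes and the conditioning event A·N.
-- Writing P = b + 2K (so b ≥ K) and w = K − u, two binomial inequalities follow:
--   K·R ≤ w·C(b,K) + u·M   (i ↦ C(b+i,K) is convex: hockey stick + monotone averages),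
--   N·C(b,K) ≤ M²          (log-concavity, checked on falling factorials),
-- so K·R·N ≤ w·M² + u·M·N.  With D = N − M, i.e. s = D/N, the claim cleared of denominators
-- is K·N·J ≤ A·(u·D·N + 2·K·D²), which follows with slack A·(u + K)·D²; it is moved to ℚ by
-- cross-multiplication in ℚᵘ.

open import Defs
open import Data.Bool using (Bool; true; false; _∧_; not)
open import Data.Bool.Properties using (∧-zeroʳ; ∧-identityʳ)
open import Data.List using (List; []; _∷_; map; _++_; filter; length; concatMap)
open import Data.List.Relation.Unary.All using (All; []; _∷_)
open import Data.List.Relation.Unary.All.Properties using (all-filter)
open import Data.Nat using (ℕ; zero; suc; _+_; _*_; _∸_; _≤_; _≤′_; ≤′-refl; ≤′-step; z≤n; _≟_; _≡ᵇ_; _!; _/_)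
open import Data.Nat.Properties
open import Data.Nat.Combinatorics using (_C_; nCk+nC[k+1]≡[n+1]C[k+1]; nCn≡1; nCk≡nPk/k!)
open import Data.Nat.Combinatorics.Base using (_P′_)
open import Data.Nat.Combinatorics.Specification using (nPk≡n!/[n∸k]!; nP′k≡n!/[n∸k]!; k!∣nP′k)
open import Data.Nat.DivMod using (m/n*n≡m)
open import Data.Nat.Tactic.RingSolver using (solve-∀)
open import Data.Integer as ℤ using (ℤ)
import Data.Integer.Properties as ℤ
open import Data.Integer.Tactic.RingSolver using () renaming (solve-∀ to ℤ-solve-∀)
open import Data.Rational using (toℚᵘ; 1ℚ) renaming (_+_ to _+ℚ_; _*_ to _*ℚ_; _≤_ to _≤ℚ_; _-_ to _-ℚ_; -_ to -ℚ_)
open import Data.Rational.Properties using (toℚᵘ-fromℚᵘ; toℚᵘ-homo-+; toℚᵘ-homo-*; toℚᵘ-homo‿-; toℚᵘ-cancel-≤)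
open import Data.Rational.Unnormalised as ℚᵘ using (ℚᵘ; mkℚᵘ; *≡*; *≤*; _≃_) renaming (_≤_ to _≤ᵘ_)
import Data.Rational.Unnormalised.Properties as ℚᵘ
open import Data.Product using (_×_; _,_)
open import Data.Fin.Subset using (Subset; inside; outside; _∩_; _∪_; ∣_∣; ⊥)
open import Data.Fin.Subset.Properties using (∣p∣≤n; ∣⊥∣≡0)
open import Data.Vec using () renaming ([] to v[]; _∷_ to _v∷_)
open import Level using (Level)
open import Relation.Nullary using (does)
open import Relation.Unary using (Pred; Decidable)
open import Relation.Binary.PropositionalEquality hiding (J)

𝟙 : Bool → ℕ
𝟙 true = 1
𝟙 false = 0

sumOver : {A : Set} → (A → ℕ) → List A → ℕ
sumOver f [] = 0
sumOver f (x ∷ xs) = f x + sumOver f xs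

count : {A : Set} → (A → Bool) → List A → ℕ
count p = sumOver (λ x → 𝟙 (p x))

length-filter : {ℓ : Level} {A : Set} {P : Pred A ℓ} (P? : Decidable P) (xs : List A) →
  length (filter P? xs) ≡ count (λ x → does (P? x)) xs
length-filter P? [] = refl
length-filter P? (x ∷ xs) with does (P? x)
... | true = cong suc (length-filter P? xs)
... | false = length-filter P? xs

count-filter : {ℓ : Level} {A : Set} {P : Pred A ℓ} (P? : Decidable P) (p : A → Bool) (xs : List A) →
  count p (filter P? xs) ≡ count (λ x → does (P? x) ∧ p x) xs
count-filter P? p [] = refl
count-filter P? p (x ∷ xs) with does (P? x)
... | true = cong (𝟙 (p x) +_) (count-filter P? p xs)
... | false = count-filter P? p xs

sumOver-++ : {A : Set} (f : A → ℕ) (xs ys : List A) → sumOver f (xs ++ ys) ≡ sumOver f xs + sumOver f ys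
sumOver-++ f [] ys = refl
sumOver-++ f (x ∷ xs) ys = trans (cong (f x +_) (sumOver-++ f xs ys)) (sym (+-assoc (f x) _ _))

sumOver-map : {A B : Set} (f : B → ℕ) (g : A → B) (xs : List A) → sumOver f (map g xs) ≡ sumOver (λ x → f (g x)) xs
sumOver-map f g [] = refl
sumOver-map f g (x ∷ xs) = cong (f (g x) +_) (sumOver-map f g xs)

sumOver-concatMap : {A B : Set} (f : B → ℕ) (g : A → List B) (xs : List A) →
  sumOver f (concatMap g xs) ≡ sumOver (λ x → sumOver f (g x)) xs
sumOver-concatMap f g [] = refl
sumOver-concatMap f g (x ∷ xs) = trans (sumOver-++ f (g x) (concatMap g xs)) (cong (sumOver f (g x) +_) (sumOver-concatMap f g xs))

sumOver-cong : {A : Set} {Q : A → Set} {f g : A → ℕ} → (∀ x → Q x → f x ≡ g x) → {xs : List A} → All Q xs → sumOver f xs ≡ sumOver g xs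
sumOver-cong e [] = refl
sumOver-cong e (qx ∷ qxs) = cong₂ _+_ (e _ qx) (sumOver-cong e qxs)

sumOver-ext : {A : Set} {f g : A → ℕ} → (∀ x → f x ≡ g x) → (xs : List A) → sumOver f xs ≡ sumOver g xs
sumOver-ext e [] = refl
sumOver-ext e (x ∷ xs) = cong₂ _+_ (e x) (sumOver-ext e xs)

sumOver-+ : {A : Set} (f g : A → ℕ) (xs : List A) → sumOver (λ x → f x + g x) xs ≡ sumOver f xs + sumOver g xs
sumOver-+ f g [] = refl
sumOver-+ f g (x ∷ xs) = trans (cong (f x + g x +_) (sumOver-+ f g xs)) (shuffle (f x) (g x) _ _)
  where
  shuffle : ∀ a b c d → a + b + (c + d) ≡ a + c + (b + d)
  shuffle = solve-∀

sumOver-*ʳ : {A : Set} (f : A → ℕ) (c : ℕ) (xs : List A) → sumOver (λ x → f x * c) xs ≡ sumOver f xs * c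
sumOver-*ʳ f c [] = refl
sumOver-*ʳ f c (x ∷ xs) = trans (cong (f x * c +_) (sumOver-*ʳ f c xs)) (sym (*-distribʳ-+ c (f x) _))

sumOver-const : {A : Set} (c : ℕ) (xs : List A) → sumOver (λ _ → c) xs ≡ c * length xs
sumOver-const c [] = sym (*-zeroʳ c)
sumOver-const c (x ∷ xs) = trans (cong (c +_) (sumOver-const c xs)) (sym (*-suc c (length xs)))

sumOver-linear : {A : Set} {Q : A → Set} (h g : A → ℕ) (c c' : ℕ) {xs : List A} → All Q xs →
  (∀ x → Q x → h x + g x * c ≡ g x * c') → sumOver h xs + sumOver g xs * c ≡ sumOver g xs * c'
sumOver-linear h g c c' {xs} qxs e = begin
  sumOver h xs + sumOver g xs * c          ≡⟨ cong (sumOver h xs +_) (sumOver-*ʳ g c xs) ⟨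
  sumOver h xs + sumOver (λ x → g x * c) xs ≡⟨ sumOver-+ h (λ x → g x * c) xs ⟨
  sumOver (λ x → h x + g x * c) xs         ≡⟨ sumOver-cong e qxs ⟩
  sumOver (λ x → g x * c') xs              ≡⟨ sumOver-*ʳ g c' xs ⟩
  sumOver g xs * c' ∎
  where open ≡-Reasoning

inclusion-exclusion : {A : Set} (a b : A → Bool) (xs : List A) →
  count (λ x → not (a x) ∧ not (b x)) xs + (count a xs + count b xs) ≡ length xs + count (λ x → a x ∧ b x) xs
inclusion-exclusion a b xs = begin
  count neither xs + (count a xs + count b xs)                 ≡⟨ cong (count neither xs +_) (sumOver-+ 𝟙a 𝟙b xs) ⟨
  count neither xs + sumOver (λ x → 𝟙a x + 𝟙b x) xs             ≡⟨ sumOver-+ (λ x → 𝟙 (neither x)) _ xs ⟨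
  sumOver (λ x → 𝟙 (neither x) + (𝟙a x + 𝟙b x)) xs             ≡⟨ sumOver-ext (λ x → pointwise (a x) (b x)) xs ⟩
  sumOver (λ x → 1 + 𝟙 (a x ∧ b x)) xs                         ≡⟨ sumOver-+ (λ _ → 1) _ xs ⟩
  sumOver (λ _ → 1) xs + count (λ x → a x ∧ b x) xs             ≡⟨ cong (_+ count (λ x → a x ∧ b x) xs) (trans (sumOver-const 1 xs) (*-identityˡ _)) ⟩
  length xs + count (λ x → a x ∧ b x) xs ∎
  where
  open ≡-Reasoning
  neither : _ → Bool
  neither x = not (a x) ∧ not (b x)
  𝟙a 𝟙b : _ → ℕ
  𝟙a x = 𝟙 (a x)
  𝟙b x = 𝟙 (b x)
  pointwise : ∀ a b → 𝟙 (not a ∧ not b) + (𝟙 a + 𝟙 b) ≡ 1 + 𝟙 (a ∧ b)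
  pointwise false false = refl
  pointwise false true = refl
  pointwise true false = refl
  pointwise true true = refl

hasSize : ∀ {n} → ℕ → Subset n → Bool
hasSize k S = does (∣ S ∣ ≟ k)

disjoint : ∀ {n} → Subset n → Subset n → Bool
disjoint T S = does (∣ T ∩ S ∣ ≟ 0)

meetsBoth : ∀ {n} → Subset n → Subset n → Subset n → Bool
meetsBoth Si Sj St = not (disjoint Si St) ∧ not (disjoint Sj St)

overlapIs : ∀ {n} → ℕ → Subset n → Subset n → Bool
overlapIs u Si Sj = does (∣ Si ∩ Sj ∣ ≟ u)

disjoint-∪ : ∀ {n} (T₁ T₂ S : Subset n) → disjoint (T₁ ∪ T₂) S ≡ disjoint T₁ S ∧ disjoint T₂ S
disjoint-∪ v[] v[] v[] = refl
disjoint-∪ (true v∷ T₁) (true v∷ T₂) (outside v∷ S) = disjoint-∪ T₁ T₂ S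
disjoint-∪ (true v∷ T₁) (false v∷ T₂) (outside v∷ S) = disjoint-∪ T₁ T₂ S
disjoint-∪ (true v∷ T₁) (y v∷ T₂) (inside v∷ S) = refl
disjoint-∪ (false v∷ T₁) (true v∷ T₂) (outside v∷ S) = disjoint-∪ T₁ T₂ S
disjoint-∪ (false v∷ T₁) (true v∷ T₂) (inside v∷ S) = sym (∧-zeroʳ _)
disjoint-∪ (false v∷ T₁) (false v∷ T₂) (outside v∷ S) = disjoint-∪ T₁ T₂ S
disjoint-∪ (false v∷ T₁) (false v∷ T₂) (inside v∷ S) = disjoint-∪ T₁ T₂ S

size-∪-∩ : ∀ {n} (T₁ T₂ : Subset n) → ∣ T₁ ∪ T₂ ∣ + ∣ T₁ ∩ T₂ ∣ ≡ ∣ T₁ ∣ + ∣ T₂ ∣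
size-∪-∩ v[] v[] = refl
size-∪-∩ (false v∷ T₁) (false v∷ T₂) = size-∪-∩ T₁ T₂
size-∪-∩ (false v∷ T₁) (true v∷ T₂) = trans (cong suc (size-∪-∩ T₁ T₂)) (sym (+-suc ∣ T₁ ∣ ∣ T₂ ∣))
size-∪-∩ (true v∷ T₁) (false v∷ T₂) = cong suc (size-∪-∩ T₁ T₂)
size-∪-∩ (true v∷ T₁) (true v∷ T₂) =
  cong suc (trans (+-suc ∣ T₁ ∪ T₂ ∣ _) (trans (cong suc (size-∪-∩ T₁ T₂)) (sym (+-suc ∣ T₁ ∣ ∣ T₂ ∣))))

-- The k-subsets of an n-set avoiding T are the k-subsets of its complement.
disjoint-subsets : ∀ n k (T : Subset n) →
  count (λ S → hasSize k S ∧ disjoint T S) (allSubsets n) ≡ (n ∸ ∣ T ∣) C k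
disjoint-subsets zero zero v[] = refl
disjoint-subsets zero (suc k) v[] = refl
disjoint-subsets (suc n) k (x v∷ T) = begin
  count (p x) (map (outside v∷_) Ss ++ map (inside v∷_) Ss)              ≡⟨ sumOver-++ _ (map (outside v∷_) Ss) _ ⟩
  count (p x) (map (outside v∷_) Ss) + count (p x) (map (inside v∷_) Ss)  ≡⟨ cong₂ _+_ (sumOver-map _ (outside v∷_) Ss) (sumOver-map _ (inside v∷_) Ss) ⟩
  count (λ S → p x (outside v∷ S)) Ss + count (λ S → p x (inside v∷ S)) Ss ≡⟨ split x ⟩
  (suc n ∸ ∣ x v∷ T ∣) C k ∎
  where
  open ≡-Reasoning
  Ss = allSubsets n
  p : Bool → Subset (suc n) → Bool
  p x S = hasSize k S ∧ disjoint (x v∷ T) S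
  avoid : ∀ x → count (λ S → p x (outside v∷ S)) Ss ≡ (n ∸ ∣ T ∣) C k
  avoid false = disjoint-subsets n k T
  avoid true = disjoint-subsets n k T
  -- a new element can be used only when it lies outside T; then Pascal's rule applies
  split : ∀ x → count (λ S → p x (outside v∷ S)) Ss + count (λ S → p x (inside v∷ S)) Ss ≡ (suc n ∸ ∣ x v∷ T ∣) C k
  split true = trans (cong₂ _+_ (avoid true) (trans (sumOver-ext (λ S → cong 𝟙 (∧-zeroʳ _)) Ss) (sumOver-const 0 Ss))) (+-identityʳ _)
  split false = trans (cong (_+ count (λ S → p false (inside v∷ S)) Ss) (avoid false)) (new-element k)
    where
    new-element : ∀ j → (n ∸ ∣ T ∣) C j + count (λ S → hasSize j (inside v∷ S) ∧ disjoint T S) Ss ≡ (suc n ∸ ∣ T ∣) C j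
    new-element zero = trans (cong (1 +_) (sumOver-const 0 Ss)) (cong (_C 0) (sym (+-∸-assoc 1 (∣p∣≤n T))))
    new-element (suc j) = begin
      (n ∸ ∣ T ∣) C suc j + count (λ S → hasSize j S ∧ disjoint T S) Ss ≡⟨ cong ((n ∸ ∣ T ∣) C suc j +_) (disjoint-subsets n j T) ⟩
      (n ∸ ∣ T ∣) C suc j + (n ∸ ∣ T ∣) C j ≡⟨ +-comm _ ((n ∸ ∣ T ∣) C j) ⟩
      (n ∸ ∣ T ∣) C j + (n ∸ ∣ T ∣) C suc j ≡⟨ nCk+nC[k+1]≡[n+1]C[k+1] (n ∸ ∣ T ∣) j ⟩
      suc (n ∸ ∣ T ∣) C suc j               ≡⟨ cong (_C suc j) (+-∸-assoc 1 (∣p∣≤n T)) ⟨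
      (suc n ∸ ∣ T ∣) C suc j ∎

disjoint-⊥ : ∀ {n} (S : Subset n) → disjoint ⊥ S ≡ true
disjoint-⊥ v[] = refl
disjoint-⊥ (x v∷ S) = disjoint-⊥ S

ring-count : ∀ n k → length (keyRings n k) ≡ n C k
ring-count n k = begin
  length (keyRings n k)                                          ≡⟨ length-filter _ (allSubsets n) ⟩
  count (hasSize k) (allSubsets n)                               ≡⟨ sumOver-ext (λ S → cong 𝟙 (avoid-⊥ S)) (allSubsets n) ⟩
  count (λ S → hasSize k S ∧ disjoint ⊥ S) (allSubsets n)        ≡⟨ disjoint-subsets n k ⊥ ⟩
  (n ∸ ∣ ⊥ {n = n} ∣) C k                                        ≡⟨ cong (λ m → (n ∸ m) C k) (∣⊥∣≡0 n) ⟩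
  n C k ∎
  where
  open ≡-Reasoning
  avoid-⊥ : ∀ S → hasSize k S ≡ hasSize k S ∧ disjoint ⊥ S
  avoid-⊥ S = sym (trans (cong (hasSize k S ∧_) (disjoint-⊥ S)) (∧-identityʳ _))

rings-avoiding : ∀ n k (T : Subset n) → count (disjoint T) (keyRings n k) ≡ (n ∸ ∣ T ∣) C k
rings-avoiding n k T = trans (count-filter _ (disjoint T) (allSubsets n)) (disjoint-subsets n k T)

rings-meeting-both : ∀ P K u (Si Sj : Subset P) → ∣ Si ∣ ≡ K → ∣ Sj ∣ ≡ K → ∣ Si ∩ Sj ∣ ≡ u →
  count (meetsBoth Si Sj) (keyRings P K) + ((P ∸ K) C K + (P ∸ K) C K) ≡ P C K + (P ∸ (K + K ∸ u)) C K
rings-meeting-both P K u Si Sj ∣Si∣≡K ∣Sj∣≡K ∣Si∩Sj∣≡u = begin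
  count (meetsBoth Si Sj) Rs + ((P ∸ K) C K + (P ∸ K) C K)
    ≡⟨ cong (count (meetsBoth Si Sj) Rs +_) (cong₂ _+_ (avoiding Si ∣Si∣≡K) (avoiding Sj ∣Sj∣≡K)) ⟨
  count (meetsBoth Si Sj) Rs + (count (disjoint Si) Rs + count (disjoint Sj) Rs)
    ≡⟨ inclusion-exclusion (disjoint Si) (disjoint Sj) Rs ⟩
  length Rs + count (λ St → disjoint Si St ∧ disjoint Sj St) Rs
    ≡⟨ cong₂ _+_ (ring-count P K) (sumOver-ext (λ St → cong 𝟙 (sym (disjoint-∪ Si Sj St))) Rs) ⟩
  P C K + count (disjoint (Si ∪ Sj)) Rs
    ≡⟨ cong (P C K +_) (rings-avoiding P K (Si ∪ Sj)) ⟩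
  P C K + (P ∸ ∣ Si ∪ Sj ∣) C K
    ≡⟨ cong (λ m → P C K + (P ∸ m) C K) size-union ⟩
  P C K + (P ∸ (K + K ∸ u)) C K ∎
  where
  open ≡-Reasoning
  Rs = keyRings P K
  avoiding : ∀ T → ∣ T ∣ ≡ K → count (disjoint T) Rs ≡ (P ∸ K) C K
  avoiding T ∣T∣≡K = trans (rings-avoiding P K T) (cong (λ m → (P ∸ m) C K) ∣T∣≡K)
  size-union : ∣ Si ∪ Sj ∣ ≡ K + K ∸ u
  size-union = begin
    ∣ Si ∪ Sj ∣                     ≡⟨ m+n∸n≡m _ u ⟨
    ∣ Si ∪ Sj ∣ + u ∸ u             ≡⟨ cong (λ m → ∣ Si ∪ Sj ∣ + m ∸ u) ∣Si∩Sj∣≡u ⟨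
    ∣ Si ∪ Sj ∣ + ∣ Si ∩ Sj ∣ ∸ u   ≡⟨ cong (_∸ u) (trans (size-∪-∩ Si Sj) (cong₂ _+_ ∣Si∣≡K ∣Sj∣≡K)) ⟩
    K + K ∸ u ∎

pairCount : ℕ → ℕ → ℕ → ℕ
pairCount P K u = sumOver (λ Si → sumOver (λ Sj → 𝟙 (overlapIs u Si Sj)) Rs) Rs
  where Rs = keyRings P K

triple-count : ∀ P K u (q : Subset P × Subset P × Subset P → Bool) (c c' : ℕ) →
  (∀ Si Sj → ∣ Si ∣ ≡ K → ∣ Sj ∣ ≡ K →
    count (λ St → q (Si , Sj , St)) (keyRings P K) + 𝟙 (overlapIs u Si Sj) * c ≡ 𝟙 (overlapIs u Si Sj) * c') →
  count q (triples P K) + pairCount P K u * c ≡ pairCount P K u * c'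
triple-count P K u q c c' per-pair =
  trans (cong (_+ pairCount P K u * c) nested)
    (sumOver-linear _ _ c c' rings-have-size λ Si ∣Si∣≡K →
      sumOver-linear _ _ c c' rings-have-size λ Sj ∣Sj∣≡K → per-pair Si Sj ∣Si∣≡K ∣Sj∣≡K)
  where
  Rs = keyRings P K
  rings-have-size : All (λ S → ∣ S ∣ ≡ K) Rs
  rings-have-size = all-filter (λ S → ∣ S ∣ ≟ K) (allSubsets P)
  nested : count q (triples P K) ≡ sumOver (λ Si → sumOver (λ Sj → count (λ St → q (Si , Sj , St)) Rs) Rs) Rs
  nested = trans (sumOver-concatMap _ _ Rs) (sumOver-ext (λ Si →
             trans (sumOver-concatMap _ _ Rs) (sumOver-ext (λ Sj → sumOver-map _ _ Rs) Rs)) Rs)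

condCount≡ : ∀ P K u → condCount P K u ≡ pairCount P K u * (P C K)
condCount≡ P K u = begin
  condCount P K u                                    ≡⟨ length-filter _ (triples P K) ⟩
  count q (triples P K)                              ≡⟨ +-identityʳ _ ⟨
  count q (triples P K) + 0                          ≡⟨ cong (count q (triples P K) +_) (*-zeroʳ (pairCount P K u)) ⟨
  count q (triples P K) + pairCount P K u * 0        ≡⟨ triple-count P K u q 0 (P C K) per-pair ⟩
  pairCount P K u * (P C K) ∎
  where
  open ≡-Reasoning
  q : Subset P × Subset P × Subset P → Bool
  q (Si , Sj , St) = overlapIs u Si Sj
  per-pair : ∀ Si Sj → ∣ Si ∣ ≡ K → ∣ Sj ∣ ≡ K →
    count (λ St → q (Si , Sj , St)) (keyRings P K) + 𝟙 (overlapIs u Si Sj) * 0 ≡ 𝟙 (overlapIs u Si Sj) * (P C K)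
  per-pair Si Sj _ _ = begin
    sumOver (λ _ → e) (keyRings P K) + e * 0  ≡⟨ cong₂ _+_ (sumOver-const e (keyRings P K)) (*-zeroʳ e) ⟩
    e * length (keyRings P K) + 0             ≡⟨ +-identityʳ _ ⟩
    e * length (keyRings P K)                 ≡⟨ cong (e *_) (ring-count P K) ⟩
    e * (P C K) ∎
    where e = 𝟙 (overlapIs u Si Sj)

jointCount≡ : ∀ P K u →
  jointCount P K u + pairCount P K u * ((P ∸ K) C K + (P ∸ K) C K) ≡ pairCount P K u * (P C K + (P ∸ (K + K ∸ u)) C K)
jointCount≡ P K u = trans (cong (_+ pairCount P K u * (M + M)) (length-filter _ (triples P K)))
                            (triple-count P K u q (M + M) (P C K + (P ∸ (K + K ∸ u)) C K) per-pair)
  where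
  M = (P ∸ K) C K
  q : Subset P × Subset P × Subset P → Bool
  q (Si , Sj , St) = overlapIs u Si Sj ∧ meetsBoth Si Sj St
  per-pair : ∀ Si Sj → ∣ Si ∣ ≡ K → ∣ Sj ∣ ≡ K →
    count (λ St → q (Si , Sj , St)) (keyRings P K) + 𝟙 (overlapIs u Si Sj) * (M + M)
      ≡ 𝟙 (overlapIs u Si Sj) * (P C K + (P ∸ (K + K ∸ u)) C K)
  per-pair Si Sj ∣Si∣≡K ∣Sj∣≡K with ∣ Si ∩ Sj ∣ ≡ᵇ u | ≡ᵇ⇒≡ ∣ Si ∩ Sj ∣ u
  ... | true | ∣Si∩Sj∣≡u = trans (cong (count (meetsBoth Si Sj) (keyRings P K) +_) (*-identityˡ _))
        (trans (rings-meeting-both P K u Si Sj ∣Si∣≡K ∣Sj∣≡K (∣Si∩Sj∣≡u _)) (sym (*-identityˡ _)))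
  ... | false | _ = trans (+-identityʳ _) (sumOver-const 0 (keyRings P K))

C-monoˡ : ∀ k {m n} → m ≤ n → m C k ≤ n C k
C-monoˡ k {m} m≤n = go (≤⇒≤′ m≤n)
  where
  step : ∀ n k → n C k ≤ suc n C k
  step n zero = ≤-refl
  step n (suc k) = subst (n C suc k ≤_) (nCk+nC[k+1]≡[n+1]C[k+1] n k) (m≤n+m _ _)
  go : ∀ {n} → m ≤′ n → m C k ≤ n C k
  go ≤′-refl = ≤-refl
  go (≤′-step m≤′n) = ≤-trans (go m≤′n) (step _ k)

C-pos : ∀ {n k} → k ≤ n → 1 ≤ n C k
C-pos {n} {k} k≤n = subst (_≤ n C k) (nCn≡1 k) (C-monoˡ k k≤n)

psum : (ℕ → ℕ) → ℕ → ℕ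
psum f zero = 0
psum f (suc i) = psum f i + f i

mean-mono : (f : ℕ → ℕ) → (∀ {i j} → i ≤ j → f i ≤ f j) → ∀ u w →
  (u + w) * psum f u ≤ u * psum f (u + w)
mean-mono f f-mono u w = begin
  (u + w) * psum f u                ≡⟨ *-distribʳ-+ (psum f u) u w ⟩
  u * psum f u + w * psum f u       ≤⟨ +-monoʳ-≤ (u * psum f u) (*-monoʳ-≤ w (below u ≤-refl)) ⟩
  u * psum f u + w * (u * f u)      ≡⟨ regroup u w (psum f u) (f u) ⟩
  u * (psum f u + w * f u)          ≤⟨ *-monoʳ-≤ u (above w) ⟩
  u * psum f (u + w) ∎
  where
  open ≤-Reasoning
  regroup : ∀ u w s d → u * s + w * (u * d) ≡ u * (s + w * d)
  regroup = solve-∀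
  below : ∀ i {j} → i ≤ j → psum f i ≤ i * f j
  below zero _ = z≤n
  below (suc i) i<j = subst (psum f i + f i ≤_) (+-comm (i * f _) (f _))
    (+-mono-≤ (below i (≤-trans (n≤1+n i) i<j)) (f-mono (≤-trans (n≤1+n i) i<j)))
  above : ∀ w → psum f u + w * f u ≤ psum f (u + w)
  above zero = ≤-reflexive (trans (+-identityʳ _) (cong (psum f) (sym (+-identityʳ u))))
  above (suc w) = begin
    psum f u + (f u + w * f u)   ≡⟨ shuffle (psum f u) (f u) (w * f u) ⟩
    (psum f u + w * f u) + f u   ≤⟨ +-mono-≤ (above w) (f-mono (m≤m+n u w)) ⟩
    psum f (u + w) + f (u + w)   ≡⟨ cong (psum f) (+-suc u w) ⟨
    psum f (u + suc w) ∎
    where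
    shuffle : ∀ s a b → s + (a + b) ≡ (s + b) + a
    shuffle = solve-∀

hockey-stick : ∀ b k i → (b + i) C suc k ≡ b C suc k + psum (λ j → (b + j) C k) i
hockey-stick b k zero = trans (cong (_C suc k) (+-identityʳ b)) (sym (+-identityʳ _))
hockey-stick b k (suc i) = begin
  (b + suc i) C suc k                               ≡⟨ cong (_C suc k) (+-suc b i) ⟩
  suc (b + i) C suc k                               ≡⟨ nCk+nC[k+1]≡[n+1]C[k+1] (b + i) k ⟨
  (b + i) C k + (b + i) C suc k                     ≡⟨ cong ((b + i) C k +_) (hockey-stick b k i) ⟩
  (b + i) C k + (b C suc k + psum D i)              ≡⟨ shuffle ((b + i) C k) (b C suc k) (psum D i) ⟩
  b C suc k + (psum D i + (b + i) C k) ∎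
  where
  open ≡-Reasoning
  D : ℕ → ℕ
  D j = (b + j) C k
  shuffle : ∀ x y z → x + (y + z) ≡ y + (z + x)
  shuffle = solve-∀

-- Convexity of i ↦ (b+i) C K: the value at u = K − w lies below the chord from 0 to K.
chord-bound : ∀ b K u w → u + w ≡ K → K * ((b + u) C K) ≤ w * (b C K) + u * ((b + K) C K)
chord-bound b zero u w _ = z≤n
chord-bound b K@(suc k) u w u+w≡K =
  subst (λ L → L * ((b + u) C K) ≤ w * G + u * ((b + L) C K)) u+w≡K (begin
    (u + w) * ((b + u) C K)                ≡⟨ cong ((u + w) *_) (hockey-stick b k u) ⟩
    (u + w) * (G + psum D u)               ≡⟨ *-distribˡ-+ (u + w) G (psum D u) ⟩
    (u + w) * G + (u + w) * psum D u       ≤⟨ +-monoʳ-≤ ((u + w) * G) (mean-mono D D-mono u w) ⟩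
    (u + w) * G + u * psum D (u + w)       ≡⟨ regroup u w G (psum D (u + w)) ⟩
    w * G + u * (G + psum D (u + w))       ≡⟨ cong (λ x → w * G + u * x) (hockey-stick b k (u + w)) ⟨
    w * G + u * ((b + (u + w)) C K) ∎)
  where
  open ≤-Reasoning
  G = b C K
  D : ℕ → ℕ
  D j = (b + j) C k
  D-mono : ∀ {i j} → i ≤ j → D i ≤ D j
  D-mono i≤j = C-monoˡ k (+-monoʳ-≤ b i≤j)
  regroup : ∀ u w g s → (u + w) * g + u * s ≡ w * g + u * (g + s)
  regroup = solve-∀

C*factorial : ∀ {n k} → k ≤ n → (n C k) * k ! ≡ n P′ k
C*factorial {n} {k} k≤n =
  -- n C k = (n P k) / k!, and n P k agrees with n P′ k = n! / (n − k)! for k ≤ n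
  trans (cong (_* k !) (trans (nCk≡nPk/k! k≤n) (cong (_/ k !) (trans (nPk≡n!/[n∸k]! k≤n) (sym (nP′k≡n!/[n∸k]! k≤n))))))
        (m/n*n≡m (k!∣nP′k k≤n))
  where instance _ = k !≢0

-- Falling factorials are log-concave in the upper index:
-- (y+2d)ₖ · yₖ ≤ ((y+d)ₖ)², factor by factor since (z+2d)·z ≤ (z+d)².
falling-log-concave : ∀ y d k → k ≤ y → ((y + (d + d)) P′ k) * (y P′ k) ≤ ((y + d) P′ k) * ((y + d) P′ k)
falling-log-concave y d zero _ = ≤-refl
falling-log-concave y d (suc k) k<y = begin
  ((y + (d + d)) ∸ k) * A * ((y ∸ k) * B)   ≡⟨ cong (λ a → a * A * (z * B)) (+-∸-comm (d + d) k≤y) ⟩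
  (z + (d + d)) * A * (z * B)               ≡⟨ interchange (z + (d + d)) A z B ⟩
  ((z + (d + d)) * z) * (A * B)             ≤⟨ *-mono-≤ (square-bound z d) (falling-log-concave y d k k≤y) ⟩
  ((z + d) * (z + d)) * (C′ * C′)           ≡⟨ interchange (z + d) C′ (z + d) C′ ⟨
  (z + d) * C′ * ((z + d) * C′)             ≡⟨ cong (λ a → a * C′ * (a * C′)) (+-∸-comm d k≤y) ⟨
  ((y + d) ∸ k) * C′ * (((y + d) ∸ k) * C′) ∎
  where
  open ≤-Reasoning
  k≤y = <⇒≤ k<y
  z = y ∸ k
  A = (y + (d + d)) P′ k
  B = y P′ k
  C′ = (y + d) P′ k
  interchange : ∀ a b c e → a * b * (c * e) ≡ (a * c) * (b * e)
  interchange = solve-∀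
  square-bound : ∀ z d → (z + (d + d)) * z ≤ (z + d) * (z + d)
  square-bound z d = subst ((z + (d + d)) * z ≤_) (sym (square z d)) (m≤m+n _ _)
    where
    square : ∀ z d → (z + d) * (z + d) ≡ (z + (d + d)) * z + d * d
    square = solve-∀

C-log-concave : ∀ b K → K ≤ b → ((b + (K + K)) C K) * (b C K) ≤ ((b + K) C K) * ((b + K) C K)
C-log-concave b K K≤b = *-cancelʳ-≤ _ _ (K ! * K !) {{m*n≢0 (K !) (K !) {{K !≢0}} {{K !≢0}}}} (begin
  ((b + (K + K)) C K) * (b C K) * (K ! * K !)  ≡⟨ interchange ((b + (K + K)) C K) (b C K) (K !) ⟩
  (((b + (K + K)) C K) * K !) * ((b C K) * K !) ≡⟨ cong₂ _*_ (C*factorial (≤-trans K≤b (m≤m+n b _))) (C*factorial K≤b) ⟩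
  ((b + (K + K)) P′ K) * (b P′ K)              ≤⟨ falling-log-concave b K K K≤b ⟩
  ((b + K) P′ K) * ((b + K) P′ K)              ≡⟨ cong₂ _*_ (C*factorial (m≤n+m K b)) (C*factorial (m≤n+m K b)) ⟨
  (((b + K) C K) * K !) * (((b + K) C K) * K !) ≡⟨ interchange ((b + K) C K) ((b + K) C K) (K !) ⟨
  ((b + K) C K) * ((b + K) C K) * (K ! * K !) ∎)
  where
  open ≤-Reasoning
  interchange : ∀ x y f → x * y * (f * f) ≡ (x * f) * (y * f)
  interchange = solve-∀

binomial-bound : ∀ b u w → let K = u + w ; M = (b + K) C K ; N = (b + (K + K)) C K in
  K ≤ b → K * ((b + u) C K) * N ≤ w * (M * M) + u * M * N
binomial-bound b u w K≤b = begin
  K * R * N                ≤⟨ *-monoˡ-≤ N (chord-bound b K u w refl) ⟩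
  (w * G + u * M) * N      ≡⟨ expand w G u M N ⟩
  w * (N * G) + u * M * N  ≤⟨ +-monoˡ-≤ (u * M * N) (*-monoʳ-≤ w (C-log-concave b K K≤b)) ⟩
  w * (M * M) + u * M * N ∎
  where
  open ≤-Reasoning
  K = u + w
  M = (b + K) C K
  N = (b + (K + K)) C K
  R = (b + u) C K
  G = b C K
  expand : ∀ w G u M N → (w * G + u * M) * N ≡ w * (N * G) + u * M * N
  expand = solve-∀

edge-binomial-bound : ∀ P K u w → let M = (P ∸ K) C K ; N = P C K in
  u + w ≡ K → 3 * K ≤ P → K * ((P ∸ (K + K ∸ u)) C K) * N ≤ w * (M * M) + u * M * N
edge-binomial-bound P _ u w refl 3K≤P =
  subst (λ Q → bound Q) (m∸n+n≡m 2K≤P) (at (P ∸ (K + K)) (m+n≤o⇒m≤o∸n K 3K≤P′))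
  where
  K = u + w
  3K≤P′ : K + (K + K) ≤ P
  3K≤P′ = subst (_≤ P) (cong (λ x → K + (K + x)) (+-identityʳ K)) 3K≤P
  2K≤P : K + K ≤ P
  2K≤P = m+n≤o⇒n≤o K 3K≤P′
  bound : ℕ → Set
  bound Q = K * ((Q ∸ (K + K ∸ u)) C K) * (Q C K) ≤ w * (((Q ∸ K) C K) * ((Q ∸ K) C K)) + u * ((Q ∸ K) C K) * (Q C K)
  minus-K : ∀ b → b + (K + K) ∸ K ≡ b + K
  minus-K b = trans (cong (_∸ K) (sym (+-assoc b K K))) (m+n∸n≡m (b + K) K)
  minus-union : ∀ b → b + (K + K) ∸ (K + K ∸ u) ≡ b + u
  minus-union b = begin
    b + (K + K) ∸ (K + K ∸ u)     ≡⟨ cong₂ _∸_ (regroup b u w) (cong (_∸ u) (two-K u w)) ⟩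
    (b + u) + (K + w) ∸ (K + w + u ∸ u) ≡⟨ cong ((b + u) + (K + w) ∸_) (m+n∸n≡m (K + w) u) ⟩
    (b + u) + (K + w) ∸ (K + w)   ≡⟨ m+n∸n≡m (b + u) (K + w) ⟩
    b + u ∎
    where
    open ≡-Reasoning
    regroup : ∀ b u w → b + ((u + w) + (u + w)) ≡ (b + u) + ((u + w) + w)
    regroup = solve-∀
    two-K : ∀ u w → (u + w) + (u + w) ≡ ((u + w) + w) + u
    two-K = solve-∀
  at : ∀ b → K ≤ b → bound (b + (K + K))
  at b K≤b = subst₂ (λ X Y → K * (Y C K) * N ≤ w * ((X C K) * (X C K)) + u * (X C K) * N)
                    (sym (minus-K b)) (sym (minus-union b)) (binomial-bound b u w K≤b)
    where N = (b + (K + K)) C K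

-- The bound with denominators cleared. With N = D + M, K = u + w and
-- J + 2AM = A(N + R), the inequality K·R·N ≤ w·M² + u·M·N yields
-- K·N·J ≤ A·(u·D·N + 2·K·D²); the slack is A·(u + K)·D².
cleared-bound : ∀ u w K D M N R A J → u + w ≡ K → D + M ≡ N →
  J + A * (M + M) ≡ A * (N + R) → K * R * N ≤ w * (M * M) + u * M * N →
  K * N * J ≤ A * (u * D * N + 2 * K * (D * D))
cleared-bound u w _ D M _ R A J refl refl joint RN-bound = +-cancelʳ-≤ Z _ _ (begin
  K * N * J + Z                                   ≡⟨ *-distribˡ-+ (K * N) J (A * (M + M)) ⟨
  K * N * (J + A * (M + M))                       ≡⟨ cong (K * N *_) joint ⟩
  K * N * (A * (N + R))                           ≡⟨ expand K N A R ⟩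
  A * (K * N * N) + A * (K * R * N)               ≤⟨ +-monoʳ-≤ (A * (K * N * N)) (*-monoʳ-≤ A RN-bound) ⟩
  A * (K * N * N) + A * (w * (M * M) + u * M * N) ≤⟨ m≤m+n _ (A * ((u + K) * (D * D))) ⟩
  A * (K * N * N) + A * (w * (M * M) + u * M * N) + A * ((u + K) * (D * D)) ≡⟨ identity u w D M A ⟩
  A * (u * D * N + 2 * K * (D * D)) + Z ∎)
  where
  open ≤-Reasoning
  K = u + w
  N = D + M
  Z = K * N * (A * (M + M))
  expand : ∀ K N A R → K * N * (A * (N + R)) ≡ A * (K * N * N) + A * (K * R * N)
  expand = solve-∀
  identity : ∀ u w D M A → let K = u + w ; N = D + M in
    A * (K * N * N) + A * (w * (M * M) + u * M * N) + A * ((u + K) * (D * D))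
      ≡ A * (u * D * N + 2 * K * (D * D)) + K * N * (A * (M + M))
  identity = solve-∀

-- Rationals: a / b is represented in ℚᵘ by fracᵘ a b, where the arithmetic is
-- cross-multiplication; toℚᵘ transfers the inequality back to ℚ.
fracᵘ : ℕ → ℕ → ℚᵘ
fracᵘ a zero = ℚᵘ.0ℚᵘ
fracᵘ a (suc b) = mkℚᵘ (ℤ.+ a) b

toℚᵘ-frac : ∀ a b → toℚᵘ (frac a b) ≃ fracᵘ a b
toℚᵘ-frac a zero = toℚᵘ-fromℚᵘ ℚᵘ.0ℚᵘ
toℚᵘ-frac a (suc b) = toℚᵘ-fromℚᵘ (mkℚᵘ (ℤ.+ a) b)

fracᵘ-* : ∀ a b c d → fracᵘ a (suc b) ℚᵘ.* fracᵘ c (suc d) ≃ fracᵘ (a * c) (suc b * suc d)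
fracᵘ-* a b c d = *≡* (cong (ℤ._* (ℤ.+ (suc b * suc d))) (sym (ℤ.pos-* a c)))

fracᵘ-+ : ∀ a b c d → fracᵘ a (suc b) ℚᵘ.+ fracᵘ c (suc d) ≃ fracᵘ (a * suc d + c * suc b) (suc b * suc d)
fracᵘ-+ a b c d = *≡* (cong (ℤ._* (ℤ.+ (suc b * suc d)))
  (sym (trans (ℤ.pos-+ (a * suc d) (c * suc b)) (cong₂ ℤ._+_ (ℤ.pos-* a (suc d)) (ℤ.pos-* c (suc b))))))

fracᵘ-≤ : ∀ a b c d → a * suc d ≤ c * b → fracᵘ a b ≤ᵘ fracᵘ c (suc d)
fracᵘ-≤ a zero c d _ = *≤* (subst₂ ℤ._≤_ (ℤ.pos-* 0 (suc d)) (ℤ.pos-* c 1) (ℤ.+≤+ z≤n))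
fracᵘ-≤ a (suc b) c d ad≤cb = *≤* (subst₂ ℤ._≤_ (ℤ.pos-* a (suc d)) (ℤ.pos-* c (suc b)) (ℤ.+≤+ ad≤cb))

one-minus : ∀ D M n → D + M ≡ suc n → toℚᵘ (1ℚ -ℚ frac M (suc n)) ≃ fracᵘ D (suc n)
one-minus D M n D+M≡N = begin
  toℚᵘ (1ℚ +ℚ (-ℚ frac M (suc n)))                      ≈⟨ toℚᵘ-homo-+ 1ℚ (-ℚ frac M (suc n)) ⟩
  toℚᵘ 1ℚ ℚᵘ.+ toℚᵘ (-ℚ frac M (suc n))                 ≈⟨ ℚᵘ.+-cong (ℚᵘ.≃-refl {toℚᵘ 1ℚ})
                                                             (ℚᵘ.≃-trans (toℚᵘ-homo‿- (frac M (suc n))) (ℚᵘ.-‿cong (toℚᵘ-frac M (suc n)))) ⟩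
  ℚᵘ.1ℚᵘ ℚᵘ.+ ℚᵘ.- fracᵘ M (suc n)                      ≈⟨ *≡* (trans (cong (λ x → (ℤ.+ 1 ℤ.* x ℤ.+ ℤ.- (ℤ.+ M) ℤ.* ℤ.+ 1) ℤ.* x) N≡D+M)
                                                             (trans (cancel (ℤ.+ D) (ℤ.+ M)) (cong (ℤ.+ D ℤ.*_) (trans (sym N≡D+M) (cong ℤ.+_ (sym (*-identityˡ (suc n)))))))) ⟩
  fracᵘ D (suc n) ∎
  where
  open ℚᵘ.≃-Reasoning
  N≡D+M : ℤ.+ suc n ≡ ℤ.+ D ℤ.+ ℤ.+ M
  N≡D+M = trans (cong ℤ.+_ (sym D+M≡N)) (ℤ.pos-+ D M)
  cancel : ∀ (d m : ℤ) → (ℤ.+ 1 ℤ.* (d ℤ.+ m) ℤ.+ ℤ.- m ℤ.* ℤ.+ 1) ℤ.* (d ℤ.+ m) ≡ d ℤ.* (d ℤ.+ m)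
  cancel = ℤ-solve-∀

ratio-bound : ∀ {Cc} J A u k M D N → 1 ≤ N → D + M ≡ N → Cc ≡ A * N →
  suc k * N * J ≤ A * (u * D * N + 2 * suc k * (D * D)) →
  frac J Cc ≤ℚ ((frac u (suc k) *ℚ (1ℚ -ℚ frac M N)) +ℚ (frac 2 1 *ℚ ((1ℚ -ℚ frac M N) *ℚ (1ℚ -ℚ frac M N))))
ratio-bound J A u k M D N@(suc n) _ D+M≡N refl cleared = toℚᵘ-cancel-≤ (begin
  toℚᵘ (frac J (A * N))                             ≃⟨ toℚᵘ-frac J (A * N) ⟩
  fracᵘ J (A * N)                                   ≤⟨ fracᵘ-≤ J (A * N) numer _ cross ⟩
  fracᵘ numer denom                                 ≃⟨ rhs ⟨
  toℚᵘ ((frac u K *ℚ s) +ℚ (frac 2 1 *ℚ (s *ℚ s))) ∎)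
  where
  open ℚᵘ.≤-Reasoning
  K = suc k
  s = 1ℚ -ℚ frac M N
  numer = u * D * (1 * (N * N)) + 2 * (D * D) * (K * N)
  denom = (K * N) * (1 * (N * N))
  cross : J * denom ≤ numer * (A * N)
  cross = subst₂ _≤_ (lhs-form K N J) (rhs-form K N A u D) (*-monoˡ-≤ (N * N) cleared)
    where
    lhs-form : ∀ K N J → K * N * J * (N * N) ≡ J * ((K * N) * (1 * (N * N)))
    lhs-form = solve-∀
    rhs-form : ∀ K N A u D → A * (u * D * N + 2 * K * (D * D)) * (N * N) ≡ (u * D * (1 * (N * N)) + 2 * (D * D) * (K * N)) * (A * N)
    rhs-form = solve-∀
  s≃ : toℚᵘ s ≃ fracᵘ D N
  s≃ = one-minus D M n D+M≡N
  first : toℚᵘ (frac u K *ℚ s) ≃ fracᵘ (u * D) (K * N)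
  first = ℚᵘ.≃-trans (toℚᵘ-homo-* (frac u K) s) (ℚᵘ.≃-trans (ℚᵘ.*-cong (toℚᵘ-frac u K) s≃) (fracᵘ-* u k D n))
  second : toℚᵘ (frac 2 1 *ℚ (s *ℚ s)) ≃ fracᵘ (2 * (D * D)) (1 * (N * N))
  second = ℚᵘ.≃-trans (toℚᵘ-homo-* (frac 2 1) (s *ℚ s)) (ℚᵘ.≃-trans
    (ℚᵘ.*-cong (toℚᵘ-frac 2 1) (ℚᵘ.≃-trans (toℚᵘ-homo-* s s) (ℚᵘ.≃-trans (ℚᵘ.*-cong s≃ s≃) (fracᵘ-* D n D n))))
    (fracᵘ-* 2 0 (D * D) _))
  rhs : toℚᵘ ((frac u K *ℚ s) +ℚ (frac 2 1 *ℚ (s *ℚ s))) ≃ fracᵘ numer denom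
  rhs = ℚᵘ.≃-trans (toℚᵘ-homo-+ (frac u K *ℚ s) (frac 2 1 *ℚ (s *ℚ s)))
          (ℚᵘ.≃-trans (ℚᵘ.+-cong first second) (fracᵘ-+ (u * D) _ (2 * (D * D)) _))

lemma5 : (K P u : ℕ) → 1 ≤ K → 3 * K ≤ P → u ≤ K →
    condProb P K u ≤ℚ ((frac u K *ℚ edgeProb P K) +ℚ (frac 2 1 *ℚ (edgeProb P K *ℚ edgeProb P K)))
lemma5 K@(suc k) P u _ 3K≤P u≤K =
  ratio-bound J A u k M (N ∸ M) N (C-pos K≤P) D+M≡N (condCount≡ P K u)
    (cleared-bound u w K (N ∸ M) M N R A J u+w≡K D+M≡N (jointCount≡ P K u) (edge-binomial-bound P K u w u+w≡K 3K≤P))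
  where
  w = K ∸ u
  N = P C K
  M = (P ∸ K) C K
  R = (P ∸ (K + K ∸ u)) C K
  A = pairCount P K u
  J = jointCount P K u
  K≤P : K ≤ P
  K≤P = m+n≤o⇒m≤o K 3K≤P
  u+w≡K : u + w ≡ K
  u+w≡K = m+[n∸m]≡n u≤K
  D+M≡N : N ∸ M + M ≡ N
  D+M≡N = m∸n+n≡m (C-monoˡ K (m∸n≤m P K))
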